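{- Let $G$ be an $(n-3)$-regular graph of order $n\ge 5$ and let $B$ be a Roman bondage set of $G$. Let $x\in V(G)$ and let $y,z$ be the only two vertices not adjacent to $x$ in $G$ (other than $x$ itself). If $E_G(x)\cap B=\{xw\}$, then $|E_G(\{y,z,w\},x')\cap B|\ge 1$ for every vertex $x'\in V(G)\setminus\{x,y,z,w\}$ that is adjacent in $G$ to each vertex of $\{y,z,w\}$.
   Context: All graphs are finite, simple and undirected. For a vertex $x$, $E_G(x)$ denotes the set of edges of $G$ incident with $x$; for disjoint vertex sets $S,T$, $E_G(S,T)$ denotes the set of edges of $G$ with one end in $S$ and the other in $T$ (a single vertex $x'$ is identified with $\{x'\}$). A Roman dominating function on $G=(V,E)$ is a function $f:V\to\{0,1,2\}$ such that every vertex $u$ with $f(u)=0$ is adjacent to some vertex $v$ with $f(v)=2$; its weight is $\sum_{u\in V}f(u)$, and $\gamma_{\rm R}(G)$ is the minimum weight of a Roman dominating function on $G$. A Roman bondage set of $G$ is a set $B\subseteq E(G)$ with $\gamma_{\rm R}(G-B)>\gamma_{\rm R}(G)$. -}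

module Defs where

open import Data.Nat using (ℕ; _<_; _∸_)
open import Data.Fin using (Fin; toℕ)
open import Data.Bool using (Bool; true; false; _∧_; not)
open import Data.List using (List; map; allFin; filter; length)
open import Data.Nat.ListAction using (sum)
open import Data.Product using (Σ; ∃; _×_; _,_)
open import Data.Empty using (⊥)
open import Relation.Binary.PropositionalEquality using (_≡_; _≢_)
open import Relation.Nullary using (¬_)
open import Data.Bool.Properties using (_≟_)

record Graph (n : ℕ) : Set where
  field
    adj   : Fin n → Fin n → Bool
    sym   : ∀ u v → adj u v ≡ adj v u
    irrefl : ∀ v → adj v v ≡ false
open Graph public

deg : ∀ {n} → Graph n → Fin n → ℕ
deg {n} G v = length (filter (λ u → adj G v u ≟ true) (allFin n))

Regular : ∀ {n} → Graph n → ℕ → Set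
Regular {n} G r = ∀ v → deg G v ≡ r

record EdgeSet {n : ℕ} (G : Graph n) : Set where
  field
    mem    : Fin n → Fin n → Bool
    memSym : ∀ u v → mem u v ≡ mem v u
    sub    : ∀ u v → mem u v ≡ true → adj G u v ≡ true
open EdgeSet public

delete : ∀ {n} (G : Graph n) → EdgeSet G → Graph n
delete G B = record
  { adj = λ u v → adj G u v ∧ not (mem B u v)
  ; sym = λ u v → helper u v
  ; irrefl = λ v → irr v }
  where
  open import Relation.Binary.PropositionalEquality using (cong₂; refl)
  helper : ∀ u v → (adj G u v ∧ not (mem B u v)) ≡ (adj G v u ∧ not (mem B v u))
  helper u v = cong₂ (λ a b → a ∧ not b) (sym G u v) (memSym B u v)
  irr : ∀ v → (adj G v v ∧ not (mem B v v)) ≡ false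
  irr v with adj G v v | irrefl G v
  ... | false | _ = refl

IsRDF : ∀ {n} → Graph n → (Fin n → Fin 3) → Set
IsRDF {n} G f = ∀ u → toℕ (f u) ≡ 0 → ∃ λ v → adj G u v ≡ true × toℕ (f v) ≡ 2

weight : ∀ {n} → (Fin n → Fin 3) → ℕ
weight {n} f = sum (map (λ u → toℕ (f u)) (allFin n))

IsγR : ∀ {n} → Graph n → ℕ → Set
IsγR G k = (∃ λ f → IsRDF G f × weight f ≡ k)
         × (∀ f → IsRDF G f → k Data.Nat.≤ weight f)

IsRomanBondageSet : ∀ {n} (G : Graph n) → EdgeSet G → Set
IsRomanBondageSet G B =
  ∀ k k' → IsγR G k → IsγR (delete G B) k' → k < k'

-- Every vertex of an (n-3)-regular graph has exactly two non-neighbours, and this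
-- forces γ_R ≥ 4 for n ≥ 5: with no label 2 the weight is at least n, and a vertex
-- labelled 2 leaves its two non-neighbours to be covered either by labels ≥ 1 or by a
-- second label 2. If B met none of the edges from y, z, w to x', then labelling x and
-- x' with 2 would still be a Roman dominating function of G - B: x dominates every
-- other vertex except y, z and w (x is joined to all but y and z, and xw is its only
-- edge in B), and x' dominates those three. Hence γ_R(G - B) = 4 = γ_R(G),
-- contradicting that B is a Roman bondage set.
module Submission where

open import Defs hiding (sym)
open import Data.Nat using (ℕ; zero; suc; _+_; _≤_; _<_; _≥_; _∸_; z≤n; s≤s) renaming (_≟_ to _≟ℕ_)
open import Data.Nat.Properties hiding (_≟_)
open import Data.Nat.ListAction using (sum)
open import Data.Fin as Fin using (Fin; toℕ; punchIn; punchOut; _≟_)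
open import Data.Fin.Patterns using (0F; 2F)
open import Data.Fin.Properties using (punchIn-injective; punchInᵢ≢i; punchIn-punchOut; punchOut-injective; any?)
open import Data.Bool using (Bool; true; false; not; _∧_)
import Data.Bool.Properties as Bool
open import Data.List using (List; []; _∷_; map; allFin; filter; length; tabulate)
open import Data.List.Properties using (map-tabulate)
open import Data.Vec.Functional using (removeAt)
open import Data.Vec.Functional.Properties using (removeAt-punchOut)
open import Algebra.Properties.CommutativeMonoid.Sum +-0-commutativeMonoid
  using (sum-remove; sum-cong-≗; sum-replicate-zero; ∑-distrib-+) renaming (sum to ∑)
open import Data.Sum using (_⊎_; inj₁; inj₂; [_,_]′)
open import Data.Product using (_×_; _,_; ∃-syntax; ∃₂)
open import Data.Empty using (⊥-elim)
open import Relation.Nullary using (¬_; Dec; yes; no)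
open import Relation.Binary.PropositionalEquality
  using (_≡_; _≢_; refl; sym; trans; cong; cong₂; subst; subst₂)
open import Function using (_∘_; id)

open ≤-Reasoning

sum-tabulate : ∀ {n} (g : Fin n → ℕ) → sum (tabulate g) ≡ ∑ g
sum-tabulate {zero}  g = refl
sum-tabulate {suc n} g = cong (g 0F +_) (sum-tabulate (g ∘ Fin.suc))

sum-map-allFin : ∀ {n} (g : Fin n → ℕ) → sum (map g (allFin n)) ≡ ∑ g
sum-map-allFin g = trans (cong sum (map-tabulate id g)) (sum-tabulate g)

∑-ones : ∀ n → ∑ {n} (λ _ → 1) ≡ n
∑-ones zero    = refl
∑-ones (suc n) = cong suc (∑-ones n)

∑-lookup≤ : ∀ {n} (g : Fin n → ℕ) i → g i ≤ ∑ g
∑-lookup≤ {suc n} g i = subst (g i ≤_) (sym (sum-remove g)) (m≤m+n (g i) _)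

∑-pair≤ : ∀ {n} (g : Fin n → ℕ) {i j} → i ≢ j → g i + g j ≤ ∑ g
∑-pair≤ {suc n} g {i} {j} i≢j = begin
  g i + g j                   ≡⟨ cong (g i +_) (removeAt-punchOut g i≢j) ⟨
  g i + removeAt g i j′       ≤⟨ +-monoʳ-≤ (g i) (∑-lookup≤ (removeAt g i) j′) ⟩
  g i + ∑ (removeAt g i)      ≡⟨ sum-remove g ⟨
  ∑ g                         ∎
  where j′ = punchOut i≢j

∑-triple≤ : ∀ {n} (g : Fin n → ℕ) {i j k} → i ≢ j → i ≢ k → j ≢ k →
            g i + g j + g k ≤ ∑ g
∑-triple≤ {suc n} g {i} {j} {k} i≢j i≢k j≢k = begin
  g i + g j + g k                  ≡⟨ +-assoc (g i) (g j) (g k) ⟩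
  g i + (g j + g k)                ≤⟨ +-monoʳ-≤ (g i) rest ⟩
  g i + ∑ (removeAt g i)           ≡⟨ sum-remove g ⟨
  ∑ g                              ∎
  where
  rest : g j + g k ≤ ∑ (removeAt g i)
  rest = subst₂ (λ a b → a + b ≤ ∑ (removeAt g i))
           (removeAt-punchOut g i≢j) (removeAt-punchOut g i≢k)
           (∑-pair≤ (removeAt g i) (j≢k ∘ punchOut-injective i≢j i≢k))

∑-positive≥ : ∀ {n} (g : Fin n → ℕ) → (∀ i → 0 < g i) → n ≤ ∑ g
∑-positive≥ {zero}  g pos = z≤n
∑-positive≥ {suc n} g pos = +-mono-≤ (pos 0F) (∑-positive≥ (g ∘ Fin.suc) (pos ∘ Fin.suc))

∑-supported-on-pair : ∀ {n} (g : Fin n → ℕ) {i j} → i ≢ j →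
                      (∀ k → k ≢ i → k ≢ j → g k ≡ 0) → ∑ g ≡ g i + g j
∑-supported-on-pair {suc zero}    g {0F} {0F} i≢i _ = ⊥-elim (i≢i refl)
∑-supported-on-pair {suc (suc n)} g {i} {j} i≢j off = begin-equality
  ∑ g                                      ≡⟨ sum-remove g ⟩
  g i + ∑ (removeAt g i)                   ≡⟨ cong (g i +_) (sum-remove (removeAt g i)) ⟩
  g i + (removeAt g i j′ + ∑ rest)         ≡⟨ cong (g i +_) (cong₂ _+_ (removeAt-punchOut g i≢j) rest≡0) ⟩
  g i + (g j + 0)                          ≡⟨ cong (g i +_) (+-identityʳ (g j)) ⟩
  g i + g j                                ∎
  where
  j′   = punchOut i≢j
  rest = removeAt (removeAt g i) j′
  rest≡0 : ∑ rest ≡ 0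
  rest≡0 = trans (sum-cong-≗ λ k → off _ (punchInᵢ≢i i _) (≢j k)) (sum-replicate-zero n)
    where
    ≢j : ∀ k → punchIn i (punchIn j′ k) ≢ j
    ≢j k e = punchInᵢ≢i j′ k (punchIn-injective i _ _ (trans e (sym (punchIn-punchOut i≢j))))

0<∑⇒∃0< : ∀ {n} (g : Fin n → ℕ) → 0 < ∑ g → ∃[ i ] 0 < g i
0<∑⇒∃0< {suc n} g 0<∑ with g 0F in eq
... | suc _ = 0F , subst (0 <_) (sym eq) (s≤s z≤n)
... | zero  with i , 0<gi ← 0<∑⇒∃0< (g ∘ Fin.suc) 0<∑ = Fin.suc i , 0<gi

1<∑⇒∃₂0< : ∀ {n} (g : Fin n → ℕ) → (∀ i → g i ≤ 1) → 1 < ∑ g →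
           ∃₂ λ i j → i ≢ j × 0 < g i × 0 < g j
1<∑⇒∃₂0< {suc n} g g≤1 1<∑ =
  let i , 0<gi = 0<∑⇒∃0< g (<-trans (s≤s z≤n) 1<∑)
      j , 0<gj = 0<∑⇒∃0< (removeAt g i) (0<rest i)
  in  i , punchIn i j , punchInᵢ≢i i j ∘ sym , 0<gi , 0<gj
  where
  0<rest : ∀ i → 0 < ∑ (removeAt g i)
  0<rest i = +-cancelˡ-< 1 0 _ (<-≤-trans 1<∑ (begin
    ∑ g                      ≡⟨ sum-remove g ⟩
    g i + ∑ (removeAt g i)   ≤⟨ +-monoˡ-≤ _ (g≤1 i) ⟩
    1 + ∑ (removeAt g i)     ∎))

indicator : Bool → ℕ
indicator false = 0
indicator true  = 1

indicator≤1 : ∀ b → indicator b ≤ 1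
indicator≤1 false = z≤n
indicator≤1 true  = s≤s z≤n

0<indicator⇒≡true : ∀ {b} → 0 < indicator b → b ≡ true
0<indicator⇒≡true {true} _ = refl

length-filter-≟true : ∀ {A : Set} (p : A → Bool) (xs : List A) →
                      length (filter (λ a → p a Bool.≟ true) xs) ≡ sum (map (indicator ∘ p) xs)
length-filter-≟true p []       = refl
length-filter-≟true p (a ∷ xs) with p a
... | true  = cong suc (length-filter-≟true p xs)
... | false = length-filter-≟true p xs

deg≡∑ : ∀ {n} (G : Graph n) v → deg G v ≡ ∑ (indicator ∘ adj G v)
deg≡∑ {n} G v = trans (length-filter-≟true (adj G v) (allFin n)) (sum-map-allFin (indicator ∘ adj G v))

∑-non-adjacent+deg : ∀ {n} (G : Graph n) v → ∑ (indicator ∘ not ∘ adj G v) + deg G v ≡ n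
∑-non-adjacent+deg {n} G v = begin-equality
  ∑ χ̄ + deg G v              ≡⟨ cong (∑ χ̄ +_) (deg≡∑ G v) ⟩
  ∑ χ̄ + ∑ χ                  ≡⟨ ∑-distrib-+ χ̄ χ ⟨
  ∑ (λ u → χ̄ u + χ u)        ≡⟨ sum-cong-≗ (complementary ∘ adj G v) ⟩
  ∑ {n} (λ _ → 1)            ≡⟨ ∑-ones n ⟩
  n                          ∎
  where
  χ χ̄ : Fin n → ℕ
  χ  = indicator ∘ adj G v
  χ̄ = indicator ∘ not ∘ adj G v
  complementary : ∀ b → indicator (not b) + indicator b ≡ 1
  complementary false = refl
  complementary true  = refl

NonNeighbour : ∀ {n} → Graph n → Fin n → Fin n → Set
NonNeighbour G v u = u ≢ v × adj G v u ≡ false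

TwoNonNeighbours : ∀ {n} → Graph n → Fin n → Set
TwoNonNeighbours G v = ∃₂ λ a b → a ≢ b × NonNeighbour G v a × NonNeighbour G v b

two-non-neighbours : ∀ {n} (G : Graph n) v → deg G v + 2 < n → TwoNonNeighbours G v
two-non-neighbours {suc n} G v deg+2<n =
  let i , j , i≢j , 0<χi , 0<χj = 1<∑⇒∃₂0< (removeAt χ v) (indicator≤1 ∘ not ∘ adj G v ∘ punchIn v) 1<∑
  in  punchIn v i , punchIn v j , i≢j ∘ punchIn-injective v i j ,
      (punchInᵢ≢i v i , non-adjacent (punchIn v i) 0<χi) ,
      (punchInᵢ≢i v j , non-adjacent (punchIn v j) 0<χj)
  where
  χ : Fin (suc n) → ℕ
  χ = indicator ∘ not ∘ adj G v
  non-adjacent : ∀ u → 0 < χ u → adj G v u ≡ false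
  non-adjacent u = Bool.not-injective ∘ 0<indicator⇒≡true
  1<∑ : 1 < ∑ (removeAt χ v)
  1<∑ = +-cancelˡ-< 1 1 _ (+-cancelʳ-< (deg G v) 2 _ (begin-strict
    2 + deg G v                       ≡⟨ +-comm 2 (deg G v) ⟩
    deg G v + 2                       <⟨ deg+2<n ⟩
    suc n                             ≡⟨ ∑-non-adjacent+deg G v ⟨
    ∑ χ + deg G v                     ≡⟨ cong (_+ deg G v) (sum-remove χ) ⟩
    χ v + ∑ (removeAt χ v) + deg G v  ≡⟨ cong (λ b → indicator (not b) + ∑ (removeAt χ v) + deg G v) (irrefl G v) ⟩
    1 + ∑ (removeAt χ v) + deg G v    ∎))

≢-of-non-adjacent : ∀ {n} (G : Graph n) {v a u} → adj G v a ≡ false → adj G a u ≡ true → u ≢ v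
≢-of-non-adjacent G {v} {a} va au refl = Bool.not-¬ refl (trans (sym au) (trans (Graph.sym G a v) va))

rdf-non-neighbour : ∀ {n} (G : Graph n) {f} → IsRDF G f → ∀ {v a} → NonNeighbour G v a →
                    0 < toℕ (f a) ⊎ ∃[ u ] u ≢ v × toℕ (f u) ≡ 2
rdf-non-neighbour G {f} rdf {v} {a} (_ , va) with f a in fa
... | Fin.suc _ = inj₁ (s≤s z≤n)
... | 0F = let u , au , fu≡2 = rdf a (cong toℕ fa) in inj₂ (u , ≢-of-non-adjacent G va au , fu≡2)

weight≥4 : ∀ {n} (G : Graph n) → 4 ≤ n → (∀ v → TwoNonNeighbours G v) →
           ∀ f → IsRDF G f → 4 ≤ weight f
weight≥4 {n} G 4≤n two f rdf = subst (4 ≤_) (sym (sum-map-allFin g)) (bound (any? λ v → g v ≟ℕ 2))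
  where
  g : Fin n → ℕ
  g = toℕ ∘ f
  two-2s : ∀ {u v} → u ≢ v → g u ≡ 2 → g v ≡ 2 → 4 ≤ ∑ g
  two-2s u≢v gu≡2 gv≡2 = subst₂ (λ p q → p + q ≤ ∑ g) gu≡2 gv≡2 (∑-pair≤ g u≢v)
  bound : Dec (∃[ v ] g v ≡ 2) → 4 ≤ ∑ g
  bound (no no-2) = ≤-trans 4≤n (∑-positive≥ g positive)
    where
    positive : ∀ u → 0 < g u
    positive u with f u in fu
    ... | Fin.suc _ = s≤s z≤n
    ... | 0F = let v , _ , gv≡2 = rdf u (cong toℕ fu) in ⊥-elim (no-2 (v , gv≡2))
  bound (yes (v , gv≡2)) with two v
  ... | a , b , a≢b , na@(a≢v , _) , nb@(b≢v , _)
    with rdf-non-neighbour G rdf na | rdf-non-neighbour G rdf nb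
  ... | inj₂ (u , u≢v , gu≡2) | _                     = two-2s u≢v gu≡2 gv≡2
  ... | inj₁ _                | inj₂ (u , u≢v , gu≡2) = two-2s u≢v gu≡2 gv≡2
  ... | inj₁ 0<ga             | inj₁ 0<gb             = begin
    2 + 1 + 1       ≤⟨ +-mono-≤ (+-monoʳ-≤ 2 0<ga) 0<gb ⟩
    2 + g a + g b   ≡⟨ cong (λ p → p + g a + g b) gv≡2 ⟨
    g v + g a + g b ≤⟨ ∑-triple≤ g (a≢v ∘ sym) (b≢v ∘ sym) a≢b ⟩
    ∑ g             ∎

IsRDF-delete⇒IsRDF : ∀ {n} (G : Graph n) (B : EdgeSet G) {f} → IsRDF (delete G B) f → IsRDF G f
IsRDF-delete⇒IsRDF G B rdf u fu≡0 =
  let v , uv , fv≡2 = rdf u fu≡0 in v , Bool.∧-conicalˡ _ _ uv , fv≡2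

adj-delete : ∀ {n} (G : Graph n) (B : EdgeSet G) {u v} →
             adj G u v ≡ true → mem B u v ≡ false → adj (delete G B) u v ≡ true
adj-delete G B uv u∉B = cong₂ (λ a m → a ∧ not m) uv u∉B

-- Deleting edges can only destroy Roman dominating functions, so a lower bound for G
-- that is attained in G - B pins both Roman domination numbers to the same value.
¬IsRomanBondageSet : ∀ {n} (G : Graph n) (B : EdgeSet G) {k} f →
                     (∀ h → IsRDF G h → k ≤ weight h) → IsRDF (delete G B) f → weight f ≡ k →
                     ¬ IsRomanBondageSet G B
¬IsRomanBondageSet G B f lower rdf wf≡k bond = <-irrefl refl (bond _ _ γR-G γR-G-B)
  where
  γR-G   = (f , IsRDF-delete⇒IsRDF G B rdf , wf≡k) , lower
  γR-G-B   = (f , rdf , wf≡k) , λ h rdfₕ → lower h (IsRDF-delete⇒IsRDF G B rdfₕ)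

twoOn : ∀ {n} → Fin n → Fin n → Fin n → Fin 3
twoOn x x' u with u ≟ x | u ≟ x'
... | no _ | no _ = 0F
... | _    | _    = 2F

twoOn-left : ∀ {n} (x x' : Fin n) → toℕ (twoOn x x' x) ≡ 2
twoOn-left x x' with x ≟ x
... | yes _   = refl
... | no x≢x  = ⊥-elim (x≢x refl)

twoOn-right : ∀ {n} (x x' : Fin n) → toℕ (twoOn x x' x') ≡ 2
twoOn-right x x' with x' ≟ x | x' ≟ x'
... | yes _ | _        = refl
... | no _  | yes _    = refl
... | no _  | no x'≢x' = ⊥-elim (x'≢x' refl)

twoOn-≡0 : ∀ {n} (x x' u : Fin n) → toℕ (twoOn x x' u) ≡ 0 → u ≢ x × u ≢ x'
twoOn-≡0 x x' u fu≡0 with u ≟ x | u ≟ x'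
... | no u≢x | no u≢x' = u≢x , u≢x'

twoOn-outside : ∀ {n} (x x' u : Fin n) → u ≢ x → u ≢ x' → toℕ (twoOn x x' u) ≡ 0
twoOn-outside x x' u u≢x u≢x' with u ≟ x | u ≟ x'
... | yes u≡x | _        = ⊥-elim (u≢x u≡x)
... | no _    | yes u≡x' = ⊥-elim (u≢x' u≡x')
... | no _    | no _     = refl

twoOn-weight : ∀ {n} {x x' : Fin n} → x ≢ x' → weight (twoOn x x') ≡ 4
twoOn-weight {x = x} {x'} x≢x' = begin-equality
  weight (twoOn x x')                              ≡⟨ sum-map-allFin (toℕ ∘ twoOn x x') ⟩
  ∑ (toℕ ∘ twoOn x x')                             ≡⟨ ∑-supported-on-pair _ x≢x' (twoOn-outside x x') ⟩
  toℕ (twoOn x x' x) + toℕ (twoOn x x' x')         ≡⟨ cong₂ _+_ (twoOn-left x x') (twoOn-right x x') ⟩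
  4                                                ∎

twoOn-IsRDF : ∀ {n} (H : Graph n) {x x'} →
              (∀ u → u ≢ x → u ≢ x' → adj H u x ≡ true ⊎ adj H u x' ≡ true) →
              IsRDF H (twoOn x x')
twoOn-IsRDF H {x} {x'} dominated u fu≡0 with twoOn-≡0 x x' u fu≡0
... | u≢x , u≢x' with dominated u u≢x u≢x'
...   | inj₁ ux  = x  , ux  , twoOn-left x x'
...   | inj₂ ux' = x' , ux' , twoOn-right x x'

lemma2p6 : ∀ (n : ℕ) → n ≥ 5 → (G : Graph n) → Regular G (n ∸ 3) →
  (B : EdgeSet G) → IsRomanBondageSet G B →
  (x y z w : Fin n) →
  y ≢ z → y ≢ x → z ≢ x →
  adj G x y ≡ false → adj G x z ≡ false →
  (∀ v → v ≢ x → adj G x v ≡ false → (v ≡ y) ⊎ (v ≡ z)) →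
  adj G x w ≡ true → mem B x w ≡ true →
  (∀ v → adj G x v ≡ true → mem B x v ≡ true → v ≡ w) →
  (x' : Fin n) → x' ≢ x → x' ≢ y → x' ≢ z → x' ≢ w →
  adj G y x' ≡ true → adj G z x' ≡ true → adj G w x' ≡ true →
  (mem B y x' ≡ true) ⊎ ((mem B z x' ≡ true) ⊎ (mem B w x' ≡ true))
lemma2p6 n 5≤n G regular B bondage x y z w _ _ _ _ _ non-neighbours-of-x _ _ xw-only-in-B
         x' x'≢x _ _ _ yx' zx' wx'
  with mem B y x' in yx'∉B | mem B z x' in zx'∉B | mem B w x' in wx'∉B
... | true  | _     | _     = inj₁ refl
... | false | true  | _     = inj₂ (inj₁ refl)
... | false | false | true  = inj₂ (inj₂ refl)
... | false | false | false =
  ⊥-elim (¬IsRomanBondageSet G B (twoOn x x') lower (twoOn-IsRDF (delete G B) dominated)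
                             (twoOn-weight (x'≢x ∘ sym)) bondage)
  where
  deg+2<n : ∀ v → deg G v + 2 < n
  deg+2<n v = subst (λ d → d + 2 < n) (sym (regular v))
                (subst (n ∸ 3 + 2 <_) (m∸n+n≡m (≤-trans (s≤s (s≤s (s≤s z≤n))) 5≤n))
                  (+-monoʳ-< (n ∸ 3) ≤-refl))
  lower : ∀ h → IsRDF G h → 4 ≤ weight h
  lower = weight≥4 G (≤-trans (n≤1+n 4) 5≤n) (λ v → two-non-neighbours G v (deg+2<n v))
  dominated : ∀ u → u ≢ x → u ≢ x' → adj (delete G B) u x ≡ true ⊎ adj (delete G B) u x' ≡ true
  dominated u u≢x _ with u ≟ y | u ≟ z | u ≟ w
  ... | yes refl | _        | _        = inj₂ (adj-delete G B yx' yx'∉B)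
  ... | no _     | yes refl | _        = inj₂ (adj-delete G B zx' zx'∉B)
  ... | no _     | no _     | yes refl = inj₂ (adj-delete G B wx' wx'∉B)
  ... | no u≢y   | no u≢z   | no u≢w   =
    inj₁ (adj-delete G B (trans (Graph.sym G u x) xu) (trans (memSym B u x) xu∉B))
    where
    xu : adj G x u ≡ true
    xu = Bool.¬-not λ xu≡false → [ u≢y , u≢z ]′ (non-neighbours-of-x u u≢x xu≡false)
    xu∉B : mem B x u ≡ false
    xu∉B = Bool.¬-not λ xu∈B → u≢w (xw-only-in-B u xu xu∈B)
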